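{- Let $1\le k\le w$ be integers, and let $(X,P)$ be the poset constructed by Anna's strategy $R(k,w)$ against an on-line chain partitioning algorithm, with realizer $\{L_\alpha,L_\beta\}$. Suppose $C_1,\ldots,C_w$ is the sequence of chains in $X$ that has the Rainbow Property. If $u\in C_k$ and $v\in X\setminus C_k$, then $u<v$ in $L_\alpha$.
   Context: Game: in each round Anna introduces a new point, and Bertha (an on-line algorithm) irrevocably gives it a color so that each color class is a chain of the poset; $c(x)$ denotes the color of $x$. Algorithm $L_\alpha(k,w)$, for positive integers $k\le w$, places the points of one "call" into a linear order $L_\alpha$, within the interval of $L_\alpha$ that the call is assigned. It is defined recursively on $w$ and has two stages. - Stage 1. Each round a new point $x$ is introduced. If $k<w$, $x$ is placed above all previous Stage-1 points of the call. If $k=w$, Anna traverses the Stage-1 points of the call upward. She inserts $x$ immediately below the first such point $y$ for which some Stage-1 point $z$ of the call with $z<y$ has $c(z)=c(y)$; if there is no such $y$, $x$ is placed on top. Stage 1 ends once the Stage-1 points of the call have received $w$ distinct colors. Let $x_N$ be the last Stage-1 point. - Stage 2. If $k<w$, Anna plays $L_\alpha(k,w-1)$ entirely below all Stage-1 points of the call. If $k=w$, she plays $L_\alpha(w-1,w-1)$ entirely above $x_N$ and below the Stage-1 points of the call lying above $x_N$ (if any). - For $w=1$, a single point is introduced. Algorithm $L_\beta(k,w)$ is defined analogously with the roles swapped. - Stage 1. If $k<w$, the new point is inserted by the traversal rule above. If $k=w$, it is placed on top of the Stage-1 points of the call. Stage 1 ends in the same way. - Stage 2. If $k<w$, Anna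 plays $L_\beta(k,w-1)$ entirely above $x_N$ and below the Stage-1 points above $x_N$. If $k=w$, she plays $L_\beta(w-1,w-1)$ entirely below all Stage-1 points. Strategy $R(k,w)$: Anna places each new point simultaneously into two linear orders $L_\alpha$ and $L_\beta$, according to $L_\alpha(k,w)$ and $L_\beta(k,w)$. The poset presented is $P=L_\alpha\cap L_\beta$. Rainbow Property: a sequence of chains $C_1,\ldots,C_w$ in $(X,P)$ has it if all of the following hold. 1. Points in different $C_i$ are incomparable in $P$. 2. Distinct points of $\bigcup_i C_i$ have distinct colors. 3. $|C_i|=i$ for each $1\le i\le w$. 4. $\bigcup_i C_i$ is a down-set in $P$. -}

module Defs where

open import Data.Nat using (ℕ; zero; suc; _≤_; _≡ᵇ_; _≤ᵇ_)
open import Data.Bool using (Bool; true; false; if_then_else_)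
open import Data.List using (List; []; _∷_; _++_; [_]; length; map; deduplicateᵇ)
open import Data.Bool.ListAction using (any)
open import Data.List.Membership.Propositional using (_∈_; _∉_)
open import Data.List.Relation.Unary.Unique.Propositional using (Unique)
open import Data.Maybe using (Maybe; just; nothing; _>>=_)
open import Data.Product using (_×_; _,_; proj₁; proj₂; ∃; ∃₂; Σ)
open import Data.Sum using (_⊎_)
open import Data.Empty using (⊥)
open import Relation.Nullary using (¬_)
open import Relation.Binary.PropositionalEquality using (_≡_; _≢_)

-- Points are natural numbers, numbered in order of introduction
-- (0, 1, 2, ...).  A linear order on the points of a call is a list,
-- written from bottom to top.  A colouring by Bertha is recorded as
-- c : ℕ → ℕ  (c i = colour given to the i-th introduced point).

-- traversal rule: insert x immediately below the first y (going upward)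
-- such that an earlier (lower) point z has c z = c y; else on top.
insTrav : (ℕ → ℕ) → ℕ → List ℕ → List ℕ → List ℕ
insTrav c x seen [] = x ∷ []
insTrav c x seen (y ∷ ys) =
  if any (λ z → c z ≡ᵇ c y) seen then x ∷ y ∷ ys
  else y ∷ insTrav c x (y ∷ seen) ys

traverseInsert : (ℕ → ℕ) → ℕ → List ℕ → List ℕ
traverseInsert c x S = insTrav c x [] S

onTop : ℕ → List ℕ → List ℕ
onTop x S = S ++ [ x ]

insertAfter : ℕ → List ℕ → List ℕ → List ℕ
insertAfter xN B [] = []
insertAfter xN B (y ∷ ys) =
  if xN ≡ᵇ y then y ∷ (B ++ ys) else y ∷ insertAfter xN B ys

numColours : (ℕ → ℕ) → List ℕ → ℕ
numColours c S = length (deduplicateᵇ _≡ᵇ_ (map c S))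

-- Stage 1 of a call of L_α(k,w) and L_β(k,w), run simultaneously.
-- Arguments: fuel, colouring, w, (k = w ?), next point index,
-- current Stage-1 blocks in L_α and in L_β.
-- Returns the Stage-1 blocks, the next free index, and x_N.
stage1 : ℕ → (ℕ → ℕ) → ℕ → Bool → ℕ → List ℕ → List ℕ →
         Maybe (List ℕ × List ℕ × ℕ × ℕ)
stage1 zero c w kw n Sα Sβ = nothing
stage1 (suc f) c w kw n Sα Sβ =
  let Sα' = if kw then traverseInsert c n Sα else onTop n Sα
      Sβ' = if kw then onTop n Sβ else traverseInsert c n Sβ
  in if w ≤ᵇ numColours c Sα'
     then just (Sα' , Sβ' , suc n , n)
     else stage1 f c w kw (suc n) Sα' Sβ'

-- play w fuel c k n :
-- A full call of L_α(k,w) and L_β(k,w) (i.e. one call of R(k,w)),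
-- starting with point index n.  Returns the blocks of the call in
-- L_α and L_β and the next free point index; nothing if out of fuel.
finish : Bool → List ℕ → List ℕ → ℕ →
         Maybe (List ℕ × List ℕ × ℕ) → Maybe (List ℕ × List ℕ × ℕ)
finish kw Sα Sβ xN nothing = nothing
finish kw Sα Sβ xN (just (Bα , Bβ , n'')) =
  if kw then just (insertAfter xN Bα Sα , Bβ ++ Sβ , n'')
  else just (Bα ++ Sα , insertAfter xN Bβ Sβ , n'')

play : ℕ → ℕ → (ℕ → ℕ) → ℕ → ℕ → Maybe (List ℕ × List ℕ × ℕ)
play zero f c k n = just ([] , [] , n)          -- never used (w ≥ 1)
play (suc zero) f c k n = just ([ n ] , [ n ] , suc n)
play (suc (suc w)) f c k n =
  stage1 f c (suc (suc w)) (k ≡ᵇ suc (suc w)) n [] [] >>= λ r →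
    finish (k ≡ᵇ suc (suc w)) (proj₁ r) (proj₁ (proj₂ r))
      (proj₂ (proj₂ (proj₂ r)))
      (play (suc w) f c (if k ≡ᵇ suc (suc w) then suc w else k)
        (proj₁ (proj₂ (proj₂ r))))

-- Anna's strategy R(k,w) from scratch (first point has index 0),
-- against the colour sequence c, finishes producing L_α, L_β.
RunR : (k w : ℕ) (c : ℕ → ℕ) (Lα Lβ : List ℕ) → Set
RunR k w c Lα Lβ = ∃₂ λ fuel N → play w fuel c k 0 ≡ just (Lα , Lβ , N)

Before : List ℕ → ℕ → ℕ → Set
Before L x y = ∃₂ λ as bs → ∃ λ cs → L ≡ as ++ x ∷ bs ++ y ∷ cs

-- strict order of P = L_α ∩ L_β
_<[_,_]_ : ℕ → List ℕ → List ℕ → ℕ → Set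
x <[ Lα , Lβ ] y = Before Lα x y × Before Lβ x y

Comparable : List ℕ → List ℕ → ℕ → ℕ → Set
Comparable Lα Lβ x y = x ≡ y ⊎ (x <[ Lα , Lβ ] y) ⊎ (y <[ Lα , Lβ ] x)

-- Bertha's colouring is legal: each colour class is a chain of P
-- (X = the points of L_α).
LegalColouring : (ℕ → ℕ) → List ℕ → List ℕ → Set
LegalColouring c Lα Lβ =
  ∀ x y → x ∈ Lα → y ∈ Lα → c x ≡ c y → Comparable Lα Lβ x y

IsChain : List ℕ → List ℕ → List ℕ → Set
IsChain Lα Lβ C = (∀ x → x ∈ C → x ∈ Lα) ×
                  (∀ x y → x ∈ C → y ∈ C → Comparable Lα Lβ x y)

InUnion : ℕ → (ℕ → List ℕ) → ℕ → Set
InUnion w C x = Σ ℕ λ i → 1 ≤ i × i ≤ w × x ∈ C i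

-- The chains are C 1, ..., C w (as duplicate-free lists).
RainbowProperty : (ℕ → ℕ) → List ℕ → List ℕ → ℕ → (ℕ → List ℕ) → Set
RainbowProperty c Lα Lβ w C =
  (∀ i → 1 ≤ i → i ≤ w → IsChain Lα Lβ (C i)) ×
  (∀ i j → 1 ≤ i → i ≤ w → 1 ≤ j → j ≤ w → i ≢ j →
     ∀ x y → x ∈ C i → y ∈ C j → ¬ Comparable Lα Lβ x y) ×
  (∀ x y → InUnion w C x → InUnion w C y → x ≢ y → c x ≢ c y) ×
  (∀ i → 1 ≤ i → i ≤ w → Unique (C i) × length (C i) ≡ i) ×
  (∀ x y → InUnion w C x → y ∈ Lα → y <[ Lα , Lβ ] x → InUnion w C y)

-- Induction on the width along the recursion of R(k, w).  Stage 1 of a call of width W leaves a block T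
-- of W points of distinct colours (the first point of each colour in traversal order), which is a chain,
-- and a block H of points repeating colours of T; the remaining points form the subcall of width W − 1.
-- So Bertha uses at most W + (W − 1) + ⋯ + 1 colours on the call, which is exactly the number of distinct
-- colours of the down-set C₁ ∪ ⋯ ∪ C_W.  A point of H lies above the point of T of its colour, so it is
-- not in the down-set, and a point of T outside it would bring one more colour; hence T ⊆ ⋃ Cᵢ, and as a
-- chain of size W, T = C_W, while the other Cᵢ lie in the subcall.  If k = W, T is the bottom of L_α;
-- otherwise the subcall is played below all Stage-1 points of L_α and we conclude by induction.

module Submission where

open import Defs
open import Data.Bool using (Bool; true; false; if_then_else_) renaming (T to True)
open import Data.Bool.ListAction using (any)
open import Data.Nat using (ℕ; zero; suc; _≤_; _<_; z≤n; s≤s; _+_; _≡ᵇ_; _≤ᵇ_)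
open import Data.Nat.Properties
  using (_≟_; ≤-refl; ≤-trans; ≤-antisym; <-irrefl; <-asym; <⇒≢; n≤1+n; n<1+n; m<n⇒m<1+n;
         m≤n⇒m≤1+n; <-≤-trans; ≤-pred; ≤∧≢⇒<; ≰⇒>; ≡ᵇ⇒≡; ≡⇒≡ᵇ; ≤ᵇ⇒≤; ≤⇒≤ᵇ)
open import Data.List using (List; []; _∷_; _++_; [_]; length; map; filter; deduplicate; deduplicateᵇ)
open import Data.List.Properties
  using (++-assoc; ++-identityʳ; length-++; length-++-sucʳ; length-map; map-++; filter-≐)
open import Data.List.Membership.Propositional using (_∈_; _∉_; find; lose)
open import Data.List.Membership.DecPropositional _≟_ using (_∈?_)
open import Data.List.Membership.Propositional.Properties
  using (∈-++⁺ˡ; ∈-++⁺ʳ; ∈-++⁻; ∈-∃++; ∈-map⁺; ∈-map⁻; ∈-deduplicate⁻; ∈-deduplicate⁺)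
open import Data.List.Relation.Unary.Any using (here; there)
open import Data.List.Relation.Unary.Any.Properties using (any⁺; any⁻)
open import Data.List.Relation.Unary.All using ([]; _∷_)
import Data.List.Relation.Unary.All as All
open import Data.List.Relation.Unary.All.Properties using (¬Any⇒All¬; All¬⇒¬Any)
open import Data.List.Relation.Unary.AllPairs using (AllPairs; []; _∷_)
import Data.List.Relation.Unary.AllPairs as AllPairs
import Data.List.Relation.Unary.AllPairs.Properties as AllPairsₚ
open import Data.List.Relation.Unary.Unique.Propositional using (Unique)
import Data.List.Relation.Unary.Unique.Propositional.Properties as Unique
open import Data.List.Relation.Unary.Unique.DecPropositional.Properties _≟_ using (deduplicate-!)
open import Data.List.Relation.Binary.Subset.Propositional using (_⊆_)
import Data.List.Relation.Binary.Subset.Propositional.Properties as ⊆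
open import Data.List.Relation.Binary.Permutation.Propositional using (↭-sym)
open import Data.List.Relation.Binary.Permutation.Propositional.Properties using (shift)
open import Data.Maybe using (Maybe; just; nothing)
open import Data.Product using (_×_; _,_; proj₁; proj₂; ∃; map₂; swap)
open import Data.Sum using (_⊎_; inj₁; inj₂)
import Data.Sum as Sum
open import Function using (_∘_)
open import Data.Empty using (⊥-elim)
open import Data.Unit using (⊤)
open import Relation.Nullary using (¬_; yes; no)
open import Relation.Binary.PropositionalEquality
  using (_≡_; _≢_; refl; sym; trans; cong; cong₂; subst; subst₂; module ≡-Reasoning)

private
  variable
    A B : Set

-- Linear orders as lists

data Precedes {A : Set} (x y : A) : List A → Set where
  first : ∀ {L} → y ∈ L → Precedes x y (x ∷ L)
  later : ∀ {z L} → Precedes x y L → Precedes x y (z ∷ L)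

Before⇒Precedes : ∀ {x y} L → Before L x y → Precedes x y L
Before⇒Precedes _ ([] , bs , cs , refl) = first (∈-++⁺ʳ bs (here refl))
Before⇒Precedes _ (a ∷ as , bs , cs , refl) = later (Before⇒Precedes _ (as , bs , cs , refl))

Precedes⇒Before : ∀ {x y L} → Precedes x y L → Before L x y
Precedes⇒Before (first y∈) with bs , cs , refl ← ∈-∃++ y∈ = [] , bs , cs , refl
Precedes⇒Before (later {z} p) with as , bs , cs , refl ← Precedes⇒Before p = z ∷ as , bs , cs , refl

Precedes-∈ˡ : ∀ {x y : A} {L} → Precedes x y L → x ∈ L
Precedes-∈ˡ (first _) = here refl
Precedes-∈ˡ (later p) = there (Precedes-∈ˡ p)

Precedes-∈ʳ : ∀ {x y : A} {L} → Precedes x y L → y ∈ L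
Precedes-∈ʳ (first y∈) = there y∈
Precedes-∈ʳ (later p) = there (Precedes-∈ʳ p)

Precedes-++⁺ˡ : ∀ {x y : A} {xs} ys → Precedes x y xs → Precedes x y (xs ++ ys)
Precedes-++⁺ˡ ys (first y∈) = first (∈-++⁺ˡ y∈)
Precedes-++⁺ˡ ys (later p) = later (Precedes-++⁺ˡ ys p)

Precedes-++⁺ʳ : ∀ {x y : A} {ys} xs → Precedes x y ys → Precedes x y (xs ++ ys)
Precedes-++⁺ʳ [] p = p
Precedes-++⁺ʳ (_ ∷ xs) p = later (Precedes-++⁺ʳ xs p)

Precedes-++⁺ : ∀ {x y : A} {xs ys} → x ∈ xs → y ∈ ys → Precedes x y (xs ++ ys)
Precedes-++⁺ {xs = _ ∷ xs} (here refl) y∈ = first (∈-++⁺ʳ xs y∈)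
Precedes-++⁺ {xs = _ ∷ xs} (there x∈) y∈ = later (Precedes-++⁺ x∈ y∈)

Precedes-++⁻ : ∀ {x y : A} {ys} xs → Precedes x y (xs ++ ys) →
               Precedes x y xs ⊎ Precedes x y ys ⊎ (x ∈ xs × y ∈ ys)
Precedes-++⁻ [] p = inj₂ (inj₁ p)
Precedes-++⁻ (_ ∷ xs) (first y∈) with ∈-++⁻ xs y∈
... | inj₁ y∈xs = inj₁ (first y∈xs)
... | inj₂ y∈ys = inj₂ (inj₂ (here refl , y∈ys))
Precedes-++⁻ (_ ∷ xs) (later p) with Precedes-++⁻ xs p
... | inj₁ q = inj₁ (later q)
... | inj₂ (inj₁ q) = inj₂ (inj₁ q)
... | inj₂ (inj₂ (x∈ , y∈)) = inj₂ (inj₂ (there x∈ , y∈))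

Precedes-asym : ∀ {x y : A} {L} → Unique L → Precedes x y L → ¬ Precedes y x L
Precedes-asym (x∉ ∷ _) (first _) (first x∈) = All¬⇒¬Any x∉ x∈
Precedes-asym (x∉ ∷ _) (first _) (later q) = All¬⇒¬Any x∉ (Precedes-∈ʳ q)
Precedes-asym (y∉ ∷ _) (later p) (first _) = All¬⇒¬Any y∉ (Precedes-∈ʳ p)
Precedes-asym (_ ∷ u) (later p) (later q) = Precedes-asym u p q

Precedes-total : ∀ {x y : A} {L} → x ∈ L → y ∈ L → x ≢ y → Precedes x y L ⊎ Precedes y x L
Precedes-total (here refl) (here refl) x≢y = ⊥-elim (x≢y refl)
Precedes-total (here refl) (there y∈) _ = inj₁ (first y∈)
Precedes-total (there x∈) (here refl) _ = inj₂ (first x∈)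
Precedes-total (there x∈) (there y∈) x≢y with Precedes-total x∈ y∈ x≢y
... | inj₁ p = inj₁ (later p)
... | inj₂ p = inj₂ (later p)

Precedes⇒R : ∀ {R : A → A → Set} {x y L} → AllPairs R L → Precedes x y L → R x y
Precedes⇒R (Rx ∷ _) (first y∈) = All.lookup Rx y∈
Precedes⇒R (_ ∷ rs) (later p) = Precedes⇒R rs p

<⇒Precedes : ∀ {x y L} → AllPairs _<_ L → x ∈ L → y ∈ L → x < y → Precedes x y L
<⇒Precedes asc x∈ y∈ x<y with Precedes-total x∈ y∈ (<⇒≢ x<y)
... | inj₁ p = p
... | inj₂ p = ⊥-elim (<-asym x<y (Precedes⇒R asc p))

Unique-disjoint : ∀ {x : A} xs {ys} → Unique (xs ++ ys) → x ∈ xs → x ∉ ys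
Unique-disjoint (_ ∷ xs) (x∉ ∷ _) (here refl) x∈ = All¬⇒¬Any x∉ (∈-++⁺ʳ xs x∈)
Unique-disjoint (_ ∷ xs) (_ ∷ u) (there x∈xs) = Unique-disjoint xs u x∈xs

Unique-++⁻ʳ : ∀ {ys} (xs : List A) → Unique (xs ++ ys) → Unique ys
Unique-++⁻ʳ [] u = u
Unique-++⁻ʳ (_ ∷ xs) (_ ∷ u) = Unique-++⁻ʳ xs u

Unique-insert : ∀ (xs : List A) {ys zs} → Unique (xs ++ zs) → Unique ys → (∀ {y} → y ∈ ys → y ∉ xs ++ zs) →
                Unique (xs ++ ys ++ zs)
Unique-insert [] u uys fresh = Unique.++⁺ uys u (λ (y∈ , y∈′) → fresh y∈ y∈′)
Unique-insert (x ∷ xs) {ys} (x∉ ∷ u) uys fresh =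
  ¬Any⇒All¬ _ x∉′ ∷ Unique-insert xs u uys (λ y∈ y∈′ → fresh y∈ (there y∈′))
  where
  x∉′ : x ∉ xs ++ ys ++ _
  x∉′ x∈ with ∈-++⁻ xs x∈
  ... | inj₁ x∈xs = All¬⇒¬Any x∉ (∈-++⁺ˡ x∈xs)
  ... | inj₂ x∈′ with ∈-++⁻ ys x∈′
  ... | inj₁ x∈ys = fresh x∈ys (here refl)
  ... | inj₂ x∈zs = All¬⇒¬Any x∉ (∈-++⁺ʳ xs x∈zs)

Precedes-infix⁻ : ∀ {x y : A} xs ys zs → Unique (xs ++ ys ++ zs) → x ∈ ys → y ∈ ys →
                  Precedes x y (xs ++ ys ++ zs) → Precedes x y ys
Precedes-infix⁻ xs ys zs u x∈ y∈ p with Precedes-++⁻ xs p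
... | inj₁ q = ⊥-elim (Unique-disjoint xs {ys ++ zs} u (Precedes-∈ˡ q) (∈-++⁺ˡ x∈))
... | inj₂ (inj₂ (x∈xs , _)) = ⊥-elim (Unique-disjoint xs {ys ++ zs} u x∈xs (∈-++⁺ˡ x∈))
... | inj₂ (inj₁ q) with Precedes-++⁻ ys q
... | inj₁ r = r
... | inj₂ (inj₁ r) = ⊥-elim (Unique-disjoint ys (Unique-++⁻ʳ xs u) x∈ (Precedes-∈ˡ r))
... | inj₂ (inj₂ (_ , y∈zs)) = ⊥-elim (Unique-disjoint ys (Unique-++⁻ʳ xs u) y∈ y∈zs)

-- Counting colours

∈-shift⁻ : ∀ {x z : A} xs {ys} → z ∈ xs ++ x ∷ ys → z ≡ x ⊎ z ∈ xs ++ ys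
∈-shift⁻ xs {ys} z∈ with ⊆.⊆-reflexive-↭ (shift _ xs ys) z∈
... | here z≡x = inj₁ z≡x
... | there z∈′ = inj₂ z∈′

Unique-⊆⇒length≤ : ∀ {xs ys : List A} → Unique xs → xs ⊆ ys → length xs ≤ length ys
Unique-⊆⇒length≤ {xs = []} _ _ = z≤n
Unique-⊆⇒length≤ {xs = x ∷ xs} (x∉ ∷ u) xs⊆ys with P , Q , refl ← ∈-∃++ (xs⊆ys (here refl)) =
  subst (suc (length xs) ≤_) (sym (length-++-sucʳ P x Q)) (s≤s (Unique-⊆⇒length≤ u xs⊆P++Q))
  where
  xs⊆P++Q : xs ⊆ P ++ Q
  xs⊆P++Q z∈ with ∈-shift⁻ P (xs⊆ys (there z∈))
  ... | inj₁ refl = ⊥-elim (All¬⇒¬Any x∉ z∈)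
  ... | inj₂ z∈′ = z∈′

numColours-deduplicate : ∀ (c : ℕ → ℕ) L → numColours c L ≡ length (deduplicate _≟_ (map c L))
numColours-deduplicate c L = cong length (dedup≡ (map c L))
  where
  dedup≡ : ∀ xs → deduplicateᵇ _≡ᵇ_ xs ≡ deduplicate _≟_ xs
  dedup≡ [] = refl
  dedup≡ (x ∷ xs) = cong (x ∷_) (trans
    (filter-≐ _ _ ((λ ¬x≡ᵇ x≡ → ¬x≡ᵇ (≡⇒≡ᵇ _ _ x≡)) , (λ ¬x≡ x≡ᵇ → ¬x≡ (≡ᵇ⇒≡ _ _ x≡ᵇ)))
              (deduplicateᵇ _≡ᵇ_ xs))
    (cong (filter _) (dedup≡ xs)))

numColours-representatives : ∀ (c : ℕ → ℕ) L G → (∀ {z} → z ∈ L → c z ∈ map c G) → G ⊆ L → Unique (map c G) →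
                             numColours c L ≡ length G
numColours-representatives c L G colours G⊆L distinct = trans (numColours-deduplicate c L) (≤-antisym
  (subst (_ ≤_) (length-map c G)
    (Unique-⊆⇒length≤ (deduplicate-! (map c L))
      (λ z∈ → colour-of (∈-map⁻ c (∈-deduplicate⁻ _≟_ (map c L) z∈)))))
  (subst (_≤ _) (length-map c G)
    (Unique-⊆⇒length≤ distinct (λ z∈ → ∈-deduplicate⁺ _≟_ (⊆.map⁺ c G⊆L z∈)))))
  where
  colour-of : ∀ {z} → (∃ λ x → x ∈ L × z ≡ c x) → z ∈ map c G
  colour-of (x , x∈ , refl) = colours x∈

Unique-map⁺ : ∀ (c : A → B) {L} → Unique L → (∀ {x y} → x ∈ L → y ∈ L → x ≢ y → c x ≢ c y) →
              Unique (map c L)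
Unique-map⁺ c [] _ = []
Unique-map⁺ c {x ∷ L} (x∉ ∷ u) distinct =
  ¬Any⇒All¬ _ cx∉ ∷ Unique-map⁺ c u (λ x∈ y∈ → distinct (there x∈) (there y∈))
  where
  cx∉ : c x ∉ map c L
  cx∉ cx∈ with y , y∈ , cx≡cy ← ∈-map⁻ c cx∈ =
    distinct (here refl) (there y∈) (λ x≡y → All¬⇒¬Any x∉ (subst (_∈ L) (sym x≡y) y∈)) cx≡cy

Unique-map⇒injective : ∀ (c : A → B) {L x y} → Unique (map c L) → x ∈ L → y ∈ L → c x ≡ c y → x ≡ y
Unique-map⇒injective c _ (here refl) (here refl) _ = refl
Unique-map⇒injective c (cx∉ ∷ _) (here refl) (there y∈) cx≡cy = ⊥-elim (All.lookup cx∉ (∈-map⁺ c y∈) cx≡cy)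
Unique-map⇒injective c (cy∉ ∷ _) (there x∈) (here refl) cx≡cy = ⊥-elim (All.lookup cy∉ (∈-map⁺ c x∈) (sym cx≡cy))
Unique-map⇒injective c (_ ∷ u) (there x∈) (there y∈) cx≡cy = Unique-map⇒injective c u x∈ y∈ cx≡cy

triangle : ℕ → ℕ
triangle zero = 0
triangle (suc i) = suc i + triangle i

ColourBound : (ℕ → ℕ) → ℕ → List ℕ → Set
ColourBound c w A = ∃ λ K → length K ≡ triangle w × (∀ {x} → x ∈ A → c x ∈ K)

-- The traversal rule and Stage 1

HeadColourIn : (ℕ → ℕ) → List ℕ → List ℕ → Set
HeadColourIn c S [] = ⊤
HeadColourIn c S (y ∷ _) = c y ∈ map c S

HeadColourIn-⊆ : ∀ {c S S′} R → S ⊆ S′ → HeadColourIn c S R → HeadColourIn c S′ R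
HeadColourIn-⊆ [] _ _ = _
HeadColourIn-⊆ {c} (_ ∷ _) S⊆S′ cy∈ = ⊆.map⁺ c S⊆S′ cy∈

-- The traversal passes the first occurrences G of their colours and stops at the first repeated colour.
insTrav-after-representatives : ∀ (c : ℕ → ℕ) x seen G R →
  (∀ {g z} → g ∈ G → z ∈ seen → c z ≢ c g) → Unique (map c G) → HeadColourIn c (G ++ seen) R →
  insTrav c x seen (G ++ R) ≡ G ++ x ∷ R
insTrav-after-representatives c x seen [] [] _ _ _ = refl
insTrav-after-representatives c x seen [] (y ∷ R) _ _ cy∈ with any (λ z → c z ≡ᵇ c y) seen in eq
... | true = refl
... | false with z , z∈ , cy≡cz ← ∈-map⁻ c cy∈ =
  ⊥-elim (subst True eq (any⁺ _ (lose z∈ (≡⇒≡ᵇ _ _ (sym cy≡cz)))))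
insTrav-after-representatives c x seen (g ∷ G) R fresh (cg∉ ∷ distinct) hd
  with any (λ z → c z ≡ᵇ c g) seen in eq
... | true with z , z∈ , cz≡ᵇcg ← find (any⁻ _ seen (subst True (sym eq) _)) =
  ⊥-elim (fresh (here refl) z∈ (≡ᵇ⇒≡ _ _ cz≡ᵇcg))
... | false = cong (g ∷_) (insTrav-after-representatives c x (g ∷ seen) G R fresh′ distinct
                (HeadColourIn-⊆ R (⊆.⊆-reflexive-↭ (↭-sym (shift g G seen))) hd))
  where
  fresh′ : ∀ {g′ z} → g′ ∈ G → z ∈ g ∷ seen → c z ≢ c g′
  fresh′ g′∈ (here refl) = All.lookup cg∉ (∈-map⁺ c g′∈)
  fresh′ g′∈ (there z∈) = fresh (there g′∈) z∈

length-snoc : ∀ (G : List ℕ) x → length (G ++ [ x ]) ≡ suc (length G)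
length-snoc G x = trans (length-++-sucʳ G x []) (cong (suc ∘ length) (++-identityʳ G))

insertAfter-∉ : ∀ {x} B G R → x ∉ G → insertAfter x B (G ++ x ∷ R) ≡ G ++ x ∷ B ++ R
insertAfter-∉ {x} B [] R _ with x ≡ᵇ x in eq
... | true = refl
... | false = ⊥-elim (subst True eq (≡⇒≡ᵇ x x refl))
insertAfter-∉ {x} B (g ∷ G) R x∉ with x ≡ᵇ g in eq
... | true = ⊥-elim (x∉ (here (≡ᵇ⇒≡ x g (subst True (sym eq) _))))
... | false = cong (g ∷_) (insertAfter-∉ B G R (λ x∈ → x∉ (there x∈)))

-- Stage 1 of either algorithm, with the traversal list first and the list in order of arrival second;
-- the flag says which of the two the termination test counts colours on.
stage1′ : Bool → ℕ → (ℕ → ℕ) → ℕ → ℕ → List ℕ → List ℕ → Maybe (List ℕ × List ℕ × ℕ × ℕ)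
stage1′ t zero c w n Tr In = nothing
stage1′ t (suc f) c w n Tr In =
  if w ≤ᵇ numColours c (if t then traverseInsert c n Tr else onTop n In)
  then just (traverseInsert c n Tr , onTop n In , suc n , n)
  else stage1′ t f c w (suc n) (traverseInsert c n Tr) (onTop n In)

stage1-traversalα : ∀ f c w n Sα Sβ → stage1 f c w true n Sα Sβ ≡ stage1′ true f c w n Sα Sβ
stage1-traversalα zero c w n Sα Sβ = refl
stage1-traversalα (suc f) c w n Sα Sβ with w ≤ᵇ numColours c (traverseInsert c n Sα)
... | true = refl
... | false = stage1-traversalα f c w (suc n) _ _

stage1-traversalβ : ∀ f c w n Sα Sβ {Fα Fβ n′ xN} → stage1 f c w false n Sα Sβ ≡ just (Fα , Fβ , n′ , xN) →
                    stage1′ false f c w n Sβ Sα ≡ just (Fβ , Fα , n′ , xN)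
stage1-traversalβ (suc f) c w n Sα Sβ eq with w ≤ᵇ numColours c (onTop n Sα)
stage1-traversalβ (suc f) c w n Sα Sβ refl | true = refl
... | false = stage1-traversalβ f c w (suc n) _ _ eq

-- G lists the first point of each colour, in the traversal order.
record Stage1Invariant (c : ℕ → ℕ) (n₀ n : ℕ) (Tr In G R : List ℕ) : Set where
  field
    traversal : Tr ≡ G ++ R
    G-distinct : Unique (map c G)
    colours : ∀ {z} → z ∈ Tr → c z ∈ map c G
    R-head : HeadColourIn c G R
    G-ascending : AllPairs _<_ G
    In-ascending : AllPairs _<_ In
    In-range : ∀ {z} → z ∈ In → n₀ ≤ z × z < n
    started : n₀ ≤ n
    Tr⊆In : Tr ⊆ In
    In⊆Tr : In ⊆ Tr
    Tr-unique : Unique Tr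

  G⊆Tr : G ⊆ Tr
  G⊆Tr g∈ = subst (_ ∈_) (sym traversal) (∈-++⁺ˡ g∈)

record Stage1Result (c : ℕ → ℕ) (W n₀ : ℕ) (Fₜ Fᵢ : List ℕ) (n′ xN : ℕ) : Set where
  field
    T H : List ℕ
    insertAfter-xN : ∀ B → insertAfter xN B Fₜ ≡ T ++ B ++ H
    T-size : length T ≡ W
    T-distinct : Unique (map c T)
    colours : ∀ {z} → z ∈ T ++ H → c z ∈ map c T
    T-ascending : AllPairs _<_ T
    Fᵢ-ascending : AllPairs _<_ Fᵢ
    Fᵢ-range : ∀ {z} → z ∈ Fᵢ → n₀ ≤ z × z < n′
    started : n₀ ≤ n′
    ⊆Fᵢ : T ++ H ⊆ Fᵢ
    Fᵢ⊆ : Fᵢ ⊆ T ++ H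
    unique : Unique (T ++ H)

numColours-invariant : ∀ t {c n₀ n Tr In G R} → Stage1Invariant c n₀ n Tr In G R →
                       numColours c (if t then Tr else In) ≡ length G
numColours-invariant true {c} {Tr = Tr} {G = G} I =
  numColours-representatives c Tr G colours G⊆Tr G-distinct
  where open Stage1Invariant I
numColours-invariant false {c} {In = In} {G = G} I =
  numColours-representatives c In G (λ z∈ → colours (In⊆Tr z∈)) (λ g∈ → Tr⊆In (G⊆Tr g∈)) G-distinct
  where open Stage1Invariant I

module Stage1Step {c : ℕ → ℕ} {n₀ n Tr In G R} (I : Stage1Invariant c n₀ n Tr In G R) where
  open Stage1Invariant I

  Tr⁺ In⁺ : List ℕ
  Tr⁺ = traverseInsert c n Tr
  In⁺ = onTop n In

  n∉Tr : n ∉ Tr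
  n∉Tr n∈ = <-irrefl refl (proj₂ (In-range (Tr⊆In n∈)))

  inserted : Tr⁺ ≡ G ++ n ∷ R
  inserted = trans (cong (insTrav c n []) traversal) (insTrav-after-representatives c n [] G R
    (λ _ ()) G-distinct (HeadColourIn-⊆ R (⊆.xs⊆xs++ys G []) R-head))

  ∈Tr⁺⁻ : ∀ {z} → z ∈ Tr⁺ → z ≡ n ⊎ z ∈ Tr
  ∈Tr⁺⁻ z∈ with ∈-shift⁻ G (subst (_ ∈_) inserted z∈)
  ... | inj₁ z≡n = inj₁ z≡n
  ... | inj₂ z∈′ = inj₂ (subst (_ ∈_) (sym traversal) z∈′)

  n∉G : n ∉ G
  n∉G n∈ = n∉Tr (G⊆Tr n∈)

  n∈Tr⁺ : n ∈ Tr⁺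
  n∈Tr⁺ = subst (n ∈_) (sym inserted) (∈-++⁺ʳ G (here refl))

  Tr⊆Tr⁺ : Tr ⊆ Tr⁺
  Tr⊆Tr⁺ z∈ with ∈-++⁻ G (subst (_ ∈_) traversal z∈)
  ... | inj₁ z∈G = subst (_ ∈_) (sym inserted) (∈-++⁺ˡ z∈G)
  ... | inj₂ z∈R = subst (_ ∈_) (sym inserted) (∈-++⁺ʳ G (there z∈R))

  In⁺-ascending : AllPairs _<_ In⁺
  In⁺-ascending = AllPairsₚ.++⁺ In-ascending ([] ∷ []) (All.tabulate (λ z∈ → proj₂ (In-range z∈) ∷ []))

  In⁺-range : ∀ {z} → z ∈ In⁺ → n₀ ≤ z × z < suc n
  In⁺-range z∈ with ∈-++⁻ In z∈
  ... | inj₁ z∈In = proj₁ (In-range z∈In) , m<n⇒m<1+n (proj₂ (In-range z∈In))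
  ... | inj₂ (here refl) = started , n<1+n n

  Tr⁺⊆In⁺ : Tr⁺ ⊆ In⁺
  Tr⁺⊆In⁺ z∈ with ∈Tr⁺⁻ z∈
  ... | inj₁ refl = ∈-++⁺ʳ In (here refl)
  ... | inj₂ z∈Tr = ∈-++⁺ˡ (Tr⊆In z∈Tr)

  In⁺⊆Tr⁺ : In⁺ ⊆ Tr⁺
  In⁺⊆Tr⁺ z∈ with ∈-++⁻ In z∈
  ... | inj₁ z∈In = Tr⊆Tr⁺ (In⊆Tr z∈In)
  ... | inj₂ (here refl) = n∈Tr⁺

  Tr⁺-unique : Unique Tr⁺
  Tr⁺-unique = subst Unique (sym inserted) (Unique-insert G (subst Unique traversal Tr-unique) ([] ∷ [])
    λ { (here refl) n∈ → n∉Tr (subst (_ ∈_) (sym traversal) n∈) })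

  repeated-colour : c n ∈ map c G → Stage1Invariant c n₀ (suc n) Tr⁺ In⁺ G (n ∷ R)
  repeated-colour cn∈ = record
    { traversal = inserted ; G-distinct = G-distinct ; colours = colours⁺ ; R-head = cn∈
    ; G-ascending = G-ascending ; In-ascending = In⁺-ascending ; In-range = In⁺-range
    ; started = m≤n⇒m≤1+n started ; Tr⊆In = Tr⁺⊆In⁺ ; In⊆Tr = In⁺⊆Tr⁺ ; Tr-unique = Tr⁺-unique }
    where
    colours⁺ : ∀ {z} → z ∈ Tr⁺ → c z ∈ map c G
    colours⁺ z∈ with ∈Tr⁺⁻ z∈
    ... | inj₁ refl = cn∈
    ... | inj₂ z∈Tr = colours z∈Tr

  new-colour : c n ∉ map c G → Stage1Invariant c n₀ (suc n) Tr⁺ In⁺ (G ++ [ n ]) R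
  new-colour cn∉ = record
    { traversal = trans inserted (sym (++-assoc G [ n ] R))
    ; G-distinct = subst Unique (sym (map-++ c G [ n ]))
        (Unique.++⁺ G-distinct ([] ∷ []) λ { (cn∈ , here refl) → cn∉ cn∈ })
    ; colours = colours⁺ ; R-head = HeadColourIn-⊆ R (⊆.xs⊆xs++ys G [ n ]) R-head
    ; G-ascending = AllPairsₚ.++⁺ G-ascending ([] ∷ [])
        (All.tabulate (λ g∈ → proj₂ (In-range (Tr⊆In (G⊆Tr g∈))) ∷ []))
    ; In-ascending = In⁺-ascending ; In-range = In⁺-range
    ; started = m≤n⇒m≤1+n started ; Tr⊆In = Tr⁺⊆In⁺ ; In⊆Tr = In⁺⊆Tr⁺ ; Tr-unique = Tr⁺-unique }
    where
    colours⁺ : ∀ {z} → z ∈ Tr⁺ → c z ∈ map c (G ++ [ n ])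
    colours⁺ z∈ with ∈Tr⁺⁻ z∈
    ... | inj₁ refl = ∈-map⁺ c (∈-++⁺ʳ G (here refl))
    ... | inj₂ z∈Tr = subst (_ ∈_) (sym (map-++ c G [ n ])) (∈-++⁺ˡ (colours z∈Tr))

Stage1Invariant⇒Result : ∀ {c W n₀ n Tr In G R x} → Stage1Invariant c n₀ n Tr In (G ++ [ x ]) R →
                         x ∉ G → length (G ++ [ x ]) ≡ W → Stage1Result c W n₀ Tr In n x
Stage1Invariant⇒Result {Tr = Tr} {G = G} {R} {x} I x∉G size = record
  { T = G ++ [ x ] ; H = R
  ; insertAfter-xN = λ B → begin
      insertAfter x B Tr            ≡⟨ cong (insertAfter x B) (trans traversal (++-assoc G [ x ] R)) ⟩
      insertAfter x B (G ++ x ∷ R)  ≡⟨ insertAfter-∉ B G R x∉G ⟩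
      G ++ x ∷ B ++ R               ≡⟨ ++-assoc G [ x ] (B ++ R) ⟨
      (G ++ [ x ]) ++ B ++ R        ∎
  ; T-size = size ; T-distinct = G-distinct
  ; colours = λ z∈ → colours (Tr∋ z∈) ; T-ascending = G-ascending
  ; Fᵢ-ascending = In-ascending ; Fᵢ-range = In-range ; started = started
  ; ⊆Fᵢ = λ z∈ → Tr⊆In (Tr∋ z∈) ; Fᵢ⊆ = λ z∈ → subst (_ ∈_) traversal (In⊆Tr z∈)
  ; unique = subst Unique traversal Tr-unique }
  where
  open Stage1Invariant I
  open ≡-Reasoning
  Tr∋ : ∀ {z} → z ∈ (G ++ [ x ]) ++ R → z ∈ _
  Tr∋ z∈ = subst (_ ∈_) (sym traversal) z∈

stage1′-result : ∀ t f {c W n₀ n Tr In G R Fₜ Fᵢ n′ xN} → Stage1Invariant c n₀ n Tr In G R → length G < W →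
                 stage1′ t f c W n Tr In ≡ just (Fₜ , Fᵢ , n′ , xN) → Stage1Result c W n₀ Fₜ Fᵢ n′ xN
stage1′-result t (suc f) {c} {W} {n₀} {n} {Tr} {In} {G} {R} {Fₜ} {Fᵢ} {n′} {xN} I G<W = step
  where
  open Stage1Step I
  step : (if W ≤ᵇ numColours c (if t then Tr⁺ else In⁺)
          then just (Tr⁺ , In⁺ , suc n , n)
          else stage1′ t f c W (suc n) Tr⁺ In⁺) ≡ just (Fₜ , Fᵢ , n′ , xN) →
         Stage1Result c W n₀ Fₜ Fᵢ n′ xN
  step eq with c n ∈? map c G | W ≤ᵇ numColours c (if t then Tr⁺ else In⁺) in done
  ... | yes cn∈ | true = ⊥-elim (<-irrefl refl (<-≤-trans G<W (subst (W ≤_)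
         (numColours-invariant t (repeated-colour cn∈)) (≤ᵇ⇒≤ W _ (subst True (sym done) _)))))
  ... | yes cn∈ | false = stage1′-result t f (repeated-colour cn∈) G<W eq
  ... | no cn∉ | false = stage1′-result t f (new-colour cn∉) (≰⇒> W≰) eq
    where
    W≰ : ¬ W ≤ length (G ++ [ n ])
    W≰ W≤ =
      subst True done (≤⇒≤ᵇ (subst (W ≤_) (sym (numColours-invariant t (new-colour cn∉))) W≤))
  step refl | no cn∉ | true = Stage1Invariant⇒Result (new-colour cn∉) n∉G (≤-antisym
    (subst (_≤ W) (sym (length-snoc G n)) G<W)
    (subst (W ≤_) (numColours-invariant t (new-colour cn∉)) (≤ᵇ⇒≤ W _ (subst True (sym done) _))))

stage1-result : ∀ t f c W n {Fₜ Fᵢ n′ xN} → 0 < W → stage1′ t f c W n [] [] ≡ just (Fₜ , Fᵢ , n′ , xN) →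
                Stage1Result c W n Fₜ Fᵢ n′ xN
stage1-result t f c W n 0<W = stage1′-result t f start 0<W
  where
  start : Stage1Invariant c n n [] [] [] []
  start = record
    { traversal = refl ; G-distinct = [] ; colours = λ () ; R-head = _ ; G-ascending = []
    ; In-ascending = [] ; In-range = λ () ; started = ≤-refl ; Tr⊆In = λ () ; In⊆Tr = λ () ; Tr-unique = [] }

-- The shape of a call

record WellFormedCall (n n″ : ℕ) (Aα Aβ : List ℕ) : Set where
  field
    ends-later : n ≤ n″
    uniqueα : Unique Aα
    uniqueβ : Unique Aβ
    range : ∀ {x} → x ∈ Aα → n ≤ x × x < n″
    α⊆β : Aα ⊆ Aβ
    β⊆α : Aβ ⊆ Aα

WellFormedCall-swap : ∀ {n n″ Aα Aβ} → WellFormedCall n n″ Aα Aβ → WellFormedCall n n″ Aβ Aα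
WellFormedCall-swap W = record
  { ends-later = ends-later ; uniqueα = uniqueβ ; uniqueβ = uniqueα
  ; range = λ x∈ → range (β⊆α x∈) ; α⊆β = β⊆α ; β⊆α = α⊆β }
  where open WellFormedCall W

Comparable-swap : ∀ {Lα Lβ x y} → Comparable Lα Lβ x y → Comparable Lβ Lα x y
Comparable-swap (inj₁ x≡y) = inj₁ x≡y
Comparable-swap (inj₂ (inj₁ (xα , xβ))) = inj₂ (inj₁ (xβ , xα))
Comparable-swap (inj₂ (inj₂ (yα , yβ))) = inj₂ (inj₂ (yβ , yα))

-- A call with orders (Aα, Aβ) and subcall (Bα, Bβ); its Stage-1 points are split into T, the first point of
-- each of the W colours, and H, the rest.
record CallFacts (c : ℕ → ℕ) (W : ℕ) (Aα Aβ Bα Bβ T H : List ℕ) : Set where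
  field
    points : ∀ {x} → x ∈ Aα → x ∈ T ⊎ x ∈ H ⊎ x ∈ Bα
    T⊆A : T ⊆ Aα
    B⊆A : Bα ⊆ Aα
    Aα⊆Aβ : Aα ⊆ Aβ
    Aβ⊆Aα : Aβ ⊆ Aα
    Bα⊆Bβ : Bα ⊆ Bβ
    Bβ⊆Bα : Bβ ⊆ Bα
    colours : ∀ {z} → z ∈ T ++ H → c z ∈ map c T
    T-distinct : Unique (map c T)
    T-size : length T ≡ W
    H≮T : ∀ {h t} → h ∈ H → t ∈ T → ¬ (h <[ Aα , Aβ ] t)
    T-chain : ∀ {t t′} → t ∈ T → t′ ∈ T → Comparable Aα Aβ t t′
    B∥T : ∀ {b t} → b ∈ Bα → t ∈ T → ¬ Comparable Aα Aβ b t
    <-B⇒A : ∀ {x y} → x <[ Bα , Bβ ] y → x <[ Aα , Aβ ] y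
    <-A⇒B : ∀ {x y} → x ∈ Bα → y ∈ Bα → x <[ Aα , Aβ ] y → x <[ Bα , Bβ ] y

CallFacts-swap : ∀ {c W Aα Aβ Bα Bβ T H} → CallFacts c W Aα Aβ Bα Bβ T H → CallFacts c W Aβ Aα Bβ Bα T H
CallFacts-swap {Bα = Bα} {Bβ} {T} {H} F = record
  { points = λ x∈ → points′ (points (Aβ⊆Aα x∈))
  ; T⊆A = λ t∈ → Aα⊆Aβ (T⊆A t∈) ; B⊆A = λ b∈ → Aα⊆Aβ (B⊆A (Bβ⊆Bα b∈))
  ; Aα⊆Aβ = Aβ⊆Aα ; Aβ⊆Aα = Aα⊆Aβ ; Bα⊆Bβ = Bβ⊆Bα ; Bβ⊆Bα = Bα⊆Bβ
  ; colours = colours ; T-distinct = T-distinct ; T-size = T-size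
  ; H≮T = λ h∈ t∈ h<t → H≮T h∈ t∈ (swap h<t)
  ; T-chain = λ t∈ t′∈ → Comparable-swap (T-chain t∈ t′∈)
  ; B∥T = λ b∈ t∈ b~t → B∥T (Bβ⊆Bα b∈) t∈ (Comparable-swap b~t)
  ; <-B⇒A = λ x<y → swap (<-B⇒A (swap x<y))
  ; <-A⇒B = λ x∈ y∈ x<y → swap (<-A⇒B (Bβ⊆Bα x∈) (Bβ⊆Bα y∈) (swap x<y)) }
  where
  open CallFacts F
  points′ : ∀ {x} → x ∈ T ⊎ x ∈ H ⊎ x ∈ Bα → x ∈ T ⊎ x ∈ H ⊎ x ∈ Bβ
  points′ (inj₁ x∈T) = inj₁ x∈T
  points′ (inj₂ (inj₁ x∈H)) = inj₂ (inj₁ x∈H)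
  points′ (inj₂ (inj₂ x∈B)) = inj₂ (inj₂ (Bα⊆Bβ x∈B))

module CallFactsProperties {c W Aα Aβ Bα Bβ T H} (F : CallFacts c W Aα Aβ Bα Bβ T H) where
  open CallFacts F

  Comparable-B⇒A : ∀ {x y} → Comparable Bα Bβ x y → Comparable Aα Aβ x y
  Comparable-B⇒A (inj₁ x≡y) = inj₁ x≡y
  Comparable-B⇒A (inj₂ (inj₁ x<y)) = inj₂ (inj₁ (<-B⇒A x<y))
  Comparable-B⇒A (inj₂ (inj₂ y<x)) = inj₂ (inj₂ (<-B⇒A y<x))

  Comparable-A⇒B : ∀ {x y} → x ∈ Bα → y ∈ Bα → Comparable Aα Aβ x y → Comparable Bα Bβ x y
  Comparable-A⇒B _ _ (inj₁ x≡y) = inj₁ x≡y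
  Comparable-A⇒B x∈ y∈ (inj₂ (inj₁ x<y)) = inj₂ (inj₁ (<-A⇒B x∈ y∈ x<y))
  Comparable-A⇒B x∈ y∈ (inj₂ (inj₂ y<x)) = inj₂ (inj₂ (<-A⇒B y∈ x∈ y<x))

  legal-sub : LegalColouring c Aα Aβ → LegalColouring c Bα Bβ
  legal-sub legal x y x∈ y∈ cx≡cy = Comparable-A⇒B x∈ y∈ (legal x y (B⊆A x∈) (B⊆A y∈) cx≡cy)

  colourBound : ∀ {w} → W ≡ suc w → ColourBound c w Bα → ColourBound c W Aα
  colourBound refl (KB , KB-size , B-colours) =
    map c T ++ KB , trans (length-++ (map c T)) (cong₂ _+_ (trans (length-map c T) T-size) KB-size) , A-colours
    where
    A-colours : ∀ {x} → x ∈ Aα → c x ∈ map c T ++ KB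
    A-colours x∈ with points x∈
    ... | inj₁ x∈T = ∈-++⁺ˡ (∈-map⁺ c x∈T)
    ... | inj₂ (inj₁ x∈H) = ∈-++⁺ˡ (colours (∈-++⁺ʳ T x∈H))
    ... | inj₂ (inj₂ x∈B) = ∈-++⁺ʳ (map c T) (B-colours x∈B)

-- The subcall is inserted right above x_N in the traversal order At and below all Stage-1 points in Ai.
module CallShape {c W n Fₜ Fᵢ n′ xN n″ Bt Bi} (S : Stage1Result c W n Fₜ Fᵢ n′ xN)
                 (B : WellFormedCall n′ n″ Bt Bi) where
  open Stage1Result S
  module B = WellFormedCall B

  At Ai : List ℕ
  At = T ++ Bt ++ H
  Ai = Bi ++ Fᵢ

  Fᵢ-fresh : ∀ {x} → x ∈ Bt → x ∉ Fᵢ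
  Fᵢ-fresh x∈ x∈′ = <-irrefl refl (<-≤-trans (proj₂ (Fᵢ-range x∈′)) (proj₁ (B.range x∈)))

  T∪H-fresh : ∀ {x} → x ∈ Bt → x ∉ T ++ H
  T∪H-fresh x∈ x∈′ = Fᵢ-fresh x∈ (⊆Fᵢ x∈′)

  At-unique : Unique At
  At-unique = Unique-insert T unique B.uniqueα T∪H-fresh

  Ai-unique : Unique Ai
  Ai-unique =
    Unique.++⁺ B.uniqueβ (AllPairs.map <⇒≢ Fᵢ-ascending) (λ (x∈ , x∈′) → Fᵢ-fresh (B.β⊆α x∈) x∈′)

  T⊆At : T ⊆ At
  T⊆At = ∈-++⁺ˡ

  Bt⊆At : Bt ⊆ At
  Bt⊆At x∈ = ∈-++⁺ʳ T (∈-++⁺ˡ x∈)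

  H⊆At : H ⊆ At
  H⊆At x∈ = ∈-++⁺ʳ T (∈-++⁺ʳ Bt x∈)

  At-points : ∀ {x} → x ∈ At → x ∈ T ⊎ x ∈ H ⊎ x ∈ Bt
  At-points x∈ with ∈-++⁻ T x∈
  ... | inj₁ x∈T = inj₁ x∈T
  ... | inj₂ x∈′ with ∈-++⁻ Bt x∈′
  ... | inj₁ x∈B = inj₂ (inj₂ x∈B)
  ... | inj₂ x∈H = inj₂ (inj₁ x∈H)

  At⊆Ai : At ⊆ Ai
  At⊆Ai x∈ with At-points x∈
  ... | inj₁ x∈T = ∈-++⁺ʳ Bi (⊆Fᵢ (∈-++⁺ˡ x∈T))
  ... | inj₂ (inj₁ x∈H) = ∈-++⁺ʳ Bi (⊆Fᵢ (∈-++⁺ʳ T x∈H))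
  ... | inj₂ (inj₂ x∈B) = ∈-++⁺ˡ (B.α⊆β x∈B)

  Ai⊆At : Ai ⊆ At
  Ai⊆At x∈ with ∈-++⁻ Bi x∈
  ... | inj₁ x∈B = Bt⊆At (B.β⊆α x∈B)
  ... | inj₂ x∈F with ∈-++⁻ T (Fᵢ⊆ x∈F)
  ... | inj₁ x∈T = T⊆At x∈T
  ... | inj₂ x∈H = H⊆At x∈H

  wellFormed : WellFormedCall n n″ At Ai
  wellFormed = record
    { ends-later = ≤-trans started B.ends-later ; uniqueα = At-unique ; uniqueβ = Ai-unique
    ; range = range ; α⊆β = At⊆Ai ; β⊆α = Ai⊆At }
    where
    stage1-range : ∀ {x} → x ∈ T ++ H → n ≤ x × x < n″
    stage1-range x∈ = map₂ (λ x<n′ → <-≤-trans x<n′ B.ends-later) (Fᵢ-range (⊆Fᵢ x∈))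
    range : ∀ {x} → x ∈ At → n ≤ x × x < n″
    range x∈ with At-points x∈
    ... | inj₁ x∈T = stage1-range (∈-++⁺ˡ x∈T)
    ... | inj₂ (inj₁ x∈H) = stage1-range (∈-++⁺ʳ T x∈H)
    ... | inj₂ (inj₂ x∈B) = ≤-trans started (proj₁ (B.range x∈B)) , proj₂ (B.range x∈B)

  -- Both linear orders list T in increasing order of arrival.
  Precedes-T⇒< : ∀ {x y} → Precedes x y T → x <[ At , Ai ] y
  Precedes-T⇒< p =
      Precedes⇒Before (Precedes-++⁺ˡ (Bt ++ H) p)
    , Precedes⇒Before (Precedes-++⁺ʳ Bi (<⇒Precedes Fᵢ-ascending (⊆Fᵢ (∈-++⁺ˡ (Precedes-∈ˡ p)))
                                           (⊆Fᵢ (∈-++⁺ˡ (Precedes-∈ʳ p))) (Precedes⇒R T-ascending p)))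

  T-chain : ∀ {t t′} → t ∈ T → t′ ∈ T → Comparable At Ai t t′
  T-chain {t} {t′} t∈ t′∈ with t ≟ t′
  ... | yes t≡t′ = inj₁ t≡t′
  ... | no t≢t′ with Precedes-total t∈ t′∈ t≢t′
  ... | inj₁ p = inj₂ (inj₁ (Precedes-T⇒< p))
  ... | inj₂ p = inj₂ (inj₂ (Precedes-T⇒< p))

  H≮T : ∀ {h t} → h ∈ H → t ∈ T → ¬ (h <[ At , Ai ] t)
  H≮T h∈ t∈ (h<t , _) = Precedes-asym At-unique (Before⇒Precedes At h<t) (Precedes-++⁺ t∈ (∈-++⁺ʳ Bt h∈))

  B∥T : ∀ {b t} → b ∈ Bt → t ∈ T → ¬ Comparable At Ai b t
  B∥T b∈ t∈ (inj₁ refl) = T∪H-fresh b∈ (∈-++⁺ˡ t∈)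
  B∥T b∈ t∈ (inj₂ (inj₁ (b<t , _))) =
    Precedes-asym At-unique (Before⇒Precedes At b<t) (Precedes-++⁺ t∈ (∈-++⁺ˡ b∈))
  B∥T b∈ t∈ (inj₂ (inj₂ (_ , t<b))) =
    Precedes-asym Ai-unique (Before⇒Precedes Ai t<b) (Precedes-++⁺ (B.α⊆β b∈) (⊆Fᵢ (∈-++⁺ˡ t∈)))

  facts : CallFacts c W At Ai Bt Bi T H
  facts = record
    { points = At-points ; T⊆A = T⊆At ; B⊆A = Bt⊆At ; Aα⊆Aβ = At⊆Ai ; Aβ⊆Aα = Ai⊆At
    ; Bα⊆Bβ = B.α⊆β ; Bβ⊆Bα = B.β⊆α ; colours = colours ; T-distinct = T-distinct ; T-size = T-size
    ; H≮T = H≮T ; T-chain = T-chain ; B∥T = B∥T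
    ; <-B⇒A = λ { (xα , xβ) → Precedes⇒Before (Precedes-++⁺ʳ T (Precedes-++⁺ˡ H (Before⇒Precedes Bt xα)))
                            , Precedes⇒Before (Precedes-++⁺ˡ Fᵢ (Before⇒Precedes Bi xβ)) }
    ; <-A⇒B = λ { x∈ y∈ (xα , xβ) →
          Precedes⇒Before (Precedes-infix⁻ T Bt H At-unique x∈ y∈ (Before⇒Precedes At xα))
        , Precedes⇒Before
            (Precedes-infix⁻ [] Bi Fᵢ Ai-unique (B.α⊆β x∈) (B.α⊆β y∈) (Before⇒Precedes Ai xβ)) } }

record Decomposition (c : ℕ → ℕ) (w f k n n″ : ℕ) (Aα Aβ : List ℕ) : Set where
  field
    Fₜ Fᵢ Bα Bβ : List ℕ
    n′ xN k′ : ℕ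
    first-stage : Stage1Result c (suc (suc w)) n Fₜ Fᵢ n′ xN
    subcall : play (suc w) f c k′ n′ ≡ just (Bα , Bβ , n″)
    shape : (k ≡ suc (suc w) × k′ ≡ suc w × Aα ≡ insertAfter xN Bα Fₜ × Aβ ≡ Bβ ++ Fᵢ)
          ⊎ (k ≢ suc (suc w) × k′ ≡ k × Aα ≡ Bα ++ Fᵢ × Aβ ≡ insertAfter xN Bβ Fₜ)

decompose : ∀ c w f k n {Aα Aβ n″} → play (suc (suc w)) f c k n ≡ just (Aα , Aβ , n″) →
            Decomposition c w f k n n″ Aα Aβ
decompose c w f k n eq with k ≡ᵇ suc (suc w) in k≟W | eq
... | true | eq′ with stage1 f c (suc (suc w)) true n [] [] in s₁ | eq′
...   | nothing | ()
...   | just (Fα , Fβ , n′ , xN) | eq″ with play (suc w) f c (suc w) n′ in sub | eq″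
...     | nothing | ()
...     | just (Bα , Bβ , _) | refl = record
  { Fₜ = Fα ; Fᵢ = Fβ ; Bα = Bα ; Bβ = Bβ ; n′ = n′ ; xN = xN ; k′ = suc w
  ; first-stage =
      stage1-result true f c (suc (suc w)) n (s≤s z≤n) (trans (sym (stage1-traversalα f c _ n [] [])) s₁)
  ; subcall = sub
  ; shape = inj₁ (≡ᵇ⇒≡ k _ (subst True (sym k≟W) _) , refl , refl , refl) }
decompose c w f k n eq | false | eq′ with stage1 f c (suc (suc w)) false n [] [] in s₁ | eq′
...   | nothing | ()
...   | just (Fα , Fβ , n′ , xN) | eq″ with play (suc w) f c k n′ in sub | eq″
...     | nothing | ()
...     | just (Bα , Bβ , _) | refl = record
  { Fₜ = Fβ ; Fᵢ = Fα ; Bα = Bα ; Bβ = Bβ ; n′ = n′ ; xN = xN ; k′ = k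
  ; first-stage = stage1-result false f c (suc (suc w)) n (s≤s z≤n) (stage1-traversalβ f c _ n [] [] s₁)
  ; subcall = sub
  ; shape = inj₂ ((λ k≡W → subst True k≟W (≡⇒≡ᵇ k _ k≡W)) , refl , refl , refl) }

record CallView (c : ℕ → ℕ) (w f k n n″ : ℕ) (Aα Aβ : List ℕ) : Set where
  field
    T H Bα Bβ : List ℕ
    n′ k′ : ℕ
    subcall : play (suc w) f c k′ n′ ≡ just (Bα , Bβ , n″)
    wellFormed : WellFormedCall n n″ Aα Aβ
    facts : CallFacts c (suc (suc w)) Aα Aβ Bα Bβ T H
    shape : (k ≡ suc (suc w) × k′ ≡ suc w × Aα ≡ T ++ Bα ++ H)
          ⊎ (k ≢ suc (suc w) × k′ ≡ k × ∃ λ F → Aα ≡ Bα ++ F)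

view-of : ∀ {c w f k n n″ Aα Aβ} (D : Decomposition c w f k n n″ Aα Aβ) →
          WellFormedCall (Decomposition.n′ D) n″ (Decomposition.Bα D) (Decomposition.Bβ D) →
          CallView c w f k n n″ Aα Aβ
view-of {c} {w} {f} {k} {n} {n″} D B with Decomposition.shape D
... | inj₁ (k≡W , k′≡ , eα , eβ) =
  subst₂ (CallView c w f k n n″) (sym (trans eα (insertAfter-xN Bα))) (sym eβ) (record
    { T = T ; H = H ; Bα = Bα ; Bβ = Bβ ; n′ = n′ ; k′ = k′ ; subcall = subcall
    ; wellFormed = wellFormed ; facts = facts ; shape = inj₁ (k≡W , k′≡ , refl) })
  where
  open Decomposition D
  open Stage1Result first-stage
  open CallShape first-stage B
... | inj₂ (k≢W , k′≡k , eα , eβ) =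
  subst₂ (CallView c w f k n n″) (sym eα) (sym (trans eβ (insertAfter-xN Bβ))) (record
    { T = T ; H = H ; Bα = Bα ; Bβ = Bβ ; n′ = n′ ; k′ = k′ ; subcall = subcall
    ; wellFormed = WellFormedCall-swap wellFormed ; facts = CallFacts-swap facts
    ; shape = inj₂ (k≢W , k′≡k , Fᵢ , refl) })
  where
  open Decomposition D
  open Stage1Result first-stage
  open CallShape first-stage (WellFormedCall-swap B)

play-wellFormed : ∀ c w f k n {Aα Aβ n″} → play w f c k n ≡ just (Aα , Aβ , n″) → WellFormedCall n n″ Aα Aβ
play-wellFormed c zero f k n refl = record
  { ends-later = ≤-refl ; uniqueα = [] ; uniqueβ = [] ; range = λ () ; α⊆β = λ () ; β⊆α = λ () }
play-wellFormed c (suc zero) f k n refl = record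
  { ends-later = n≤1+n n ; uniqueα = [] ∷ [] ; uniqueβ = [] ∷ []
  ; range = λ { (here refl) → ≤-refl , n<1+n n } ; α⊆β = λ x∈ → x∈ ; β⊆α = λ x∈ → x∈ }
play-wellFormed c (suc (suc w)) f k n eq =
  CallView.wellFormed (view-of D (play-wellFormed c (suc w) f k′ n′ subcall))
  where
  D = decompose c w f k n eq
  open Decomposition D

view : ∀ c w f k n {Aα Aβ n″} → play (suc (suc w)) f c k n ≡ just (Aα , Aβ , n″) → CallView c w f k n n″ Aα Aβ
view c w f k n eq = view-of D (play-wellFormed c (suc w) f k′ n′ subcall)
  where
  D = decompose c w f k n eq
  open Decomposition D

play-colourBound : ∀ c w f k n {Aα Aβ n″} → play w f c k n ≡ just (Aα , Aβ , n″) → ColourBound c w Aα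
play-colourBound c zero f k n refl = [] , refl , λ ()
play-colourBound c (suc zero) f k n refl = c n ∷ [] , refl , λ { (here refl) → here refl }
play-colourBound c (suc (suc w)) f k n eq =
  CallFactsProperties.colourBound facts refl (play-colourBound c (suc w) f k′ n′ subcall)
  where open CallView (view c w f k n eq)

-- Rainbow chains

chains : (ℕ → List ℕ) → ℕ → List ℕ
chains C zero = []
chains C (suc i) = C (suc i) ++ chains C i

∈-chains⁻ : ∀ C m {x} → x ∈ chains C m → InUnion m C x
∈-chains⁻ C (suc m) x∈ with ∈-++⁻ (C (suc m)) x∈
... | inj₁ x∈C = suc m , s≤s z≤n , ≤-refl , x∈C
... | inj₂ x∈′ with i , 1≤i , i≤m , x∈Ci ← ∈-chains⁻ C m x∈′ = i , 1≤i , m≤n⇒m≤1+n i≤m , x∈Ci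

module Rainbow {c Lα Lβ W C} (RB : RainbowProperty c Lα Lβ W C) where

  is-chain : ∀ i → 1 ≤ i → i ≤ W → IsChain Lα Lβ (C i)
  is-chain = proj₁ RB

  incomparable : ∀ i j → 1 ≤ i → i ≤ W → 1 ≤ j → j ≤ W → i ≢ j →
                 ∀ x y → x ∈ C i → y ∈ C j → ¬ Comparable Lα Lβ x y
  incomparable = proj₁ (proj₂ RB)

  distinct-colours : ∀ x y → InUnion W C x → InUnion W C y → x ≢ y → c x ≢ c y
  distinct-colours = proj₁ (proj₂ (proj₂ RB))

  sizes : ∀ i → 1 ≤ i → i ≤ W → Unique (C i) × length (C i) ≡ i
  sizes = proj₁ (proj₂ (proj₂ (proj₂ RB)))

  down-closed : ∀ x y → InUnion W C x → y ∈ Lα → y <[ Lα , Lβ ] x → InUnion W C y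
  down-closed = proj₂ (proj₂ (proj₂ (proj₂ RB)))

  union⊆L : ∀ {x} → InUnion W C x → x ∈ Lα
  union⊆L (i , 1≤i , i≤W , x∈) = proj₁ (is-chain i 1≤i i≤W) _ x∈

  disjoint : ∀ {i j x} → 1 ≤ i → i ≤ W → 1 ≤ j → j ≤ W → x ∈ C i → x ∈ C j → i ≡ j
  disjoint {i} {j} {x} 1≤i i≤W 1≤j j≤W x∈Ci x∈Cj with i ≟ j
  ... | yes i≡j = i≡j
  ... | no i≢j = ⊥-elim (incomparable i j 1≤i i≤W 1≤j j≤W i≢j x x x∈Ci x∈Cj (inj₁ refl))

  chains-unique : ∀ m → m ≤ W → Unique (chains C m)
  chains-unique zero _ = []
  chains-unique (suc m) 1+m≤W =
    Unique.++⁺ (proj₁ (sizes (suc m) (s≤s z≤n) 1+m≤W)) (chains-unique m (≤-trans (n≤1+n m) 1+m≤W)) fresh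
    where
    fresh : ∀ {x} → ¬ (x ∈ C (suc m) × x ∈ chains C m)
    fresh (x∈ , x∈′) with i , 1≤i , i≤m , x∈Ci ← ∈-chains⁻ C m x∈′ =
      <-irrefl (sym (disjoint (s≤s z≤n) 1+m≤W 1≤i (≤-trans (m≤n⇒m≤1+n i≤m) 1+m≤W) x∈ x∈Ci)) (s≤s i≤m)

  chains-colours-unique : Unique (map c (chains C W))
  chains-colours-unique = Unique-map⁺ c (chains-unique W ≤-refl)
    (λ x∈ y∈ → distinct-colours _ _ (∈-chains⁻ C W x∈) (∈-chains⁻ C W y∈))

  chains-size : length (chains C W) ≡ triangle W
  chains-size = size W ≤-refl
    where
    size : ∀ m → m ≤ W → length (chains C m) ≡ triangle m
    size zero _ = refl
    size (suc m) 1+m≤W = trans (length-++ (C (suc m)))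
      (cong₂ _+_ (proj₂ (sizes (suc m) (s≤s z≤n) 1+m≤W)) (size m (≤-trans (n≤1+n m) 1+m≤W)))

module RainbowCall {c w Aα Aβ Bα Bβ T H C}
  (F : CallFacts c (suc w) Aα Aβ Bα Bβ T H) (legal : LegalColouring c Aα Aβ)
  (RB : RainbowProperty c Aα Aβ (suc w) C) (B-bound : ColourBound c w Bα) where

  open CallFacts F
  open CallFactsProperties F
  open Rainbow RB

  W : ℕ
  W = suc w

  -- A point of H repeats the colour of a point of T and lies above it, so the down-set would hold both.
  union∩H⊆T : ∀ {x} → InUnion W C x → x ∈ H → x ∈ T
  union∩H⊆T {x} x∈U x∈H with t , t∈ , cx≡ct ← ∈-map⁻ c (colours (∈-++⁺ʳ T x∈H))
                         with legal x t (union⊆L x∈U) (T⊆A t∈) cx≡ct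
  ... | inj₁ refl = t∈
  ... | inj₂ (inj₁ x<t) = ⊥-elim (H≮T x∈H t∈ x<t)
  ... | inj₂ (inj₂ t<x) with x ≟ t
  ... | yes refl = t∈
  ... | no x≢t = ⊥-elim (distinct-colours x t x∈U (down-closed x t x∈U (T⊆A t∈) t<x) x≢t cx≡ct)

  union⊆T∪B : ∀ {x} → InUnion W C x → x ∈ T ⊎ x ∈ Bα
  union⊆T∪B x∈U with points (union⊆L x∈U)
  ... | inj₁ x∈T = inj₁ x∈T
  ... | inj₂ (inj₁ x∈H) = inj₁ (union∩H⊆T x∈U x∈H)
  ... | inj₂ (inj₂ x∈B) = inj₂ x∈B

  -- The union has triangle W distinct colours, all among the triangle W colours of the call;
  -- a point of T outside the union would contribute one more.
  T⊆union : ∀ {t} → t ∈ T → InUnion W C t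
  T⊆union {t} t∈ with t ∈? chains C W
  ... | yes t∈D = ∈-chains⁻ C W t∈D
  ... | no t∉D with K , K-size , A-colours ← colourBound refl B-bound =
    ⊥-elim (<-irrefl refl (subst₂ _≤_ (cong suc (trans (length-map c (chains C W)) chains-size)) K-size
      (Unique-⊆⇒length≤ (¬Any⇒All¬ _ ct∉ ∷ chains-colours-unique) ⊆K)))
    where
    ct∉ : c t ∉ map c (chains C W)
    ct∉ ct∈ with d , d∈ , ct≡cd ← ∈-map⁻ c ct∈ with union⊆T∪B (∈-chains⁻ C W d∈)
    ... | inj₁ d∈T = t∉D (subst (_∈ chains C W) (sym (Unique-map⇒injective c T-distinct t∈ d∈T ct≡cd)) d∈)
    ... | inj₂ d∈B = B∥T d∈B t∈ (legal _ t (B⊆A d∈B) (T⊆A t∈) (sym ct≡cd))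
    ⊆K : c t ∷ map c (chains C W) ⊆ K
    ⊆K (here refl) = A-colours (T⊆A t∈)
    ⊆K (there z∈) with d , d∈ , refl ← ∈-map⁻ c z∈ = A-colours (union⊆L (∈-chains⁻ C W d∈))

  T-nonempty : ∃ λ t₀ → t₀ ∈ T
  T-nonempty = nonempty T T-size
    where
    nonempty : ∀ (L : List ℕ) {m} → length L ≡ suc m → ∃ λ x → x ∈ L
    nonempty (x ∷ _) _ = x , here refl

  -- T is a chain, so it lies in a single C_j, and |T| = W forces j = W.
  T⊆C-top : T ⊆ C W
  T⊆C-top with t₀ , t₀∈ ← T-nonempty with j , 1≤j , j≤W , t₀∈Cj ← T⊆union t₀∈ =
    λ t∈ → subst (λ i → _ ∈ C i) j≡W (T⊆Cj t∈)
    where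
    T⊆Cj : T ⊆ C j
    T⊆Cj {t} t∈ with i , 1≤i , i≤W , t∈Ci ← T⊆union t∈ with i ≟ j
    ... | yes refl = t∈Ci
    ... | no i≢j = ⊥-elim (incomparable i j 1≤i i≤W 1≤j j≤W i≢j t _ t∈Ci t₀∈Cj (T-chain t∈ t₀∈))
    j≡W : j ≡ W
    j≡W = ≤-antisym j≤W (subst₂ _≤_ T-size (proj₂ (sizes j 1≤j j≤W))
      (Unique-⊆⇒length≤ (Unique.map⁻ T-distinct) T⊆Cj))

  C-top⊆T : C W ⊆ T
  C-top⊆T x∈ with union⊆T∪B (W , s≤s z≤n , ≤-refl , x∈)
  ... | inj₁ x∈T = x∈T
  ... | inj₂ x∈B with t₀ , t₀∈ ← T-nonempty =
    ⊥-elim (B∥T x∈B t₀∈ (proj₂ (is-chain W (s≤s z≤n) ≤-refl) _ _ x∈ (T⊆C-top t₀∈)))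

  lower⊆B : ∀ {i x} → 1 ≤ i → i ≤ w → x ∈ C i → x ∈ Bα
  lower⊆B {i} 1≤i i≤w x∈ with union⊆T∪B (i , 1≤i , m≤n⇒m≤1+n i≤w , x∈)
  ... | inj₂ x∈B = x∈B
  ... | inj₁ x∈T =
    ⊥-elim (<-irrefl (disjoint 1≤i (m≤n⇒m≤1+n i≤w) (s≤s z≤n) ≤-refl x∈ (T⊆C-top x∈T)) (s≤s i≤w))

  restricted : RainbowProperty c Bα Bβ w C
  restricted =
      (λ i 1≤i i≤w → (λ x x∈ → lower⊆B 1≤i i≤w x∈)
                   , (λ x y x∈ y∈ → Comparable-A⇒B (lower⊆B 1≤i i≤w x∈) (lower⊆B 1≤i i≤w y∈)
                                      (proj₂ (is-chain i 1≤i (m≤n⇒m≤1+n i≤w)) x y x∈ y∈)))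
    , (λ i j 1≤i i≤w 1≤j j≤w i≢j x y x∈ y∈ x~y →
         incomparable i j 1≤i (m≤n⇒m≤1+n i≤w) 1≤j (m≤n⇒m≤1+n j≤w) i≢j x y x∈ y∈ (Comparable-B⇒A x~y))
    , (λ x y x∈U y∈U → distinct-colours x y (widen x∈U) (widen y∈U))
    , (λ i 1≤i i≤w → sizes i 1≤i (m≤n⇒m≤1+n i≤w))
    , down
    where
    widen : ∀ {x} → InUnion w C x → InUnion W C x
    widen (i , 1≤i , i≤w , x∈) = i , 1≤i , m≤n⇒m≤1+n i≤w , x∈
    down : ∀ x y → InUnion w C x → y ∈ Bα → y <[ Bα , Bβ ] x → InUnion w C y
    down x y x∈U y∈B y<x with down-closed x y (widen x∈U) (B⊆A y∈B) (<-B⇒A y<x)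
    ... | i , 1≤i , i≤W , y∈Ci with i ≟ W
    ... | yes refl = ⊥-elim (B∥T y∈B (C-top⊆T y∈Ci) (inj₁ refl))
    ... | no i≢W = i , 1≤i , ≤-pred (≤∧≢⇒< i≤W i≢W) , y∈Ci

rainbow-Cₖ-initial : ∀ c w f k n {Aα Aβ n″} → play w f c k n ≡ just (Aα , Aβ , n″) →
  1 ≤ k → k ≤ w → LegalColouring c Aα Aβ → (C : ℕ → List ℕ) → RainbowProperty c Aα Aβ w C →
  ∀ u v → u ∈ C k → v ∈ Aα → v ∉ C k → Before Aα u v
rainbow-Cₖ-initial c (suc zero) f (suc zero) n refl _ _ _ C RB u v u∈ (here refl) v∉
  with here refl ← proj₁ (proj₁ RB 1 (s≤s z≤n) ≤-refl) u u∈ = ⊥-elim (v∉ u∈)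
rainbow-Cₖ-initial c (suc zero) f (suc (suc k)) n _ _ (s≤s ()) _ _ _ _ _ _ _ _
rainbow-Cₖ-initial c (suc (suc w)) f k n {Aα} eq 1≤k k≤W legal C RB u v u∈ v∈ v∉ =
  Sum.[ (λ (k≡W , _ , Aα≡) → top k≡W Aα≡)
      , (λ (k≢W , k′≡k , F , Aα≡) → lower k≢W F Aα≡ λ v∈B →
          rainbow-Cₖ-initial c (suc w) f k n′
            (subst (λ i → play (suc w) f c i n′ ≡ just (Bα , Bβ , _)) k′≡k subcall)
            1≤k (k≤w k≢W) (legal-sub legal) C restricted u v u∈ v∈B v∉) ] shape
  where
  open CallView (view c w f k n eq)
  open RainbowCall facts legal RB (play-colourBound c (suc w) f k′ n′ subcall)
  open CallFactsProperties facts
  k≤w : k ≢ suc (suc w) → k ≤ suc w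
  k≤w k≢W = ≤-pred (≤∧≢⇒< k≤W k≢W)
  top : k ≡ suc (suc w) → Aα ≡ T ++ Bα ++ H → Before Aα u v
  top k≡W Aα≡ with ∈-++⁻ T (subst (v ∈_) Aα≡ v∈)
  ... | inj₁ v∈T = ⊥-elim (v∉ (subst (λ i → v ∈ C i) (sym k≡W) (T⊆C-top v∈T)))
  ... | inj₂ v∈B∪H = subst (λ A → Before A u v) (sym Aα≡)
          (Precedes⇒Before (Precedes-++⁺ (C-top⊆T (subst (λ i → u ∈ C i) k≡W u∈)) v∈B∪H))
  lower : k ≢ suc (suc w) → ∀ F → Aα ≡ Bα ++ F → (v ∈ Bα → Before Bα u v) → Before Aα u v
  lower k≢W F Aα≡ in-subcall with ∈-++⁻ Bα (subst (v ∈_) Aα≡ v∈)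
  ... | inj₁ v∈B = subst (λ A → Before A u v) (sym Aα≡)
          (Precedes⇒Before (Precedes-++⁺ˡ F (Before⇒Precedes Bα (in-subcall v∈B))))
  ... | inj₂ v∈F = subst (λ A → Before A u v) (sym Aα≡)
          (Precedes⇒Before (Precedes-++⁺ (lower⊆B 1≤k (k≤w k≢W) u∈) v∈F))

lemma3p4 : (k w : ℕ) → 1 ≤ k → k ≤ w →
    (c : ℕ → ℕ) (Lα Lβ : List ℕ) →
    RunR k w c Lα Lβ →
    LegalColouring c Lα Lβ →
    (C : ℕ → List ℕ) → RainbowProperty c Lα Lβ w C →
    ∀ u v → u ∈ C k → v ∈ Lα → v ∉ C k → Before Lα u v
lemma3p4 k w 1≤k k≤w c Lα Lβ (fuel , _ , run) = rainbow-Cₖ-initial c w fuel k 0 run 1≤k k≤w
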